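{- For all $q>2$ and $n\ge 2$ there exists a negative orientable sequence of order $n$ over $\mathbb{Z}_q$ with period $\frac{q^n-r_{q,n,nq/2}}{2}$, where $r_{q,n,s}$ denotes the number of $q$-ary $n$-tuples with pseudoweight exactly $s$.
   Context: Sequences are periodic with entries in $\mathbb{Z}_q$. For $S=(s_i)$ write $\mathbf{s}_n(i)=(s_i,\ldots,s_{i+n-1})$; for an $n$-tuple $\mathbf{u}=(u_0,\ldots,u_{n-1})$ let $\mathbf{u}^R=(u_{n-1},\ldots,u_0)$ and $-\mathbf{u}=(-u_0,\ldots,-u_{n-1})$. A periodic sequence of period $m$ is an $n$-window sequence if $\mathbf{s}_n(i)=\mathbf{s}_n(j)$ implies $i\equiv j\pmod m$; it is a negative orientable sequence of order $n$ if also $\mathbf{s}_n(i)\neq-\mathbf{s}_n(j)^R$ for all $i,j$. Pseudoweight: define $f:\mathbb{Z}_q\to\mathbb{Q}$ by treating $u$ as an integer in $[0,q-1]$, $f(u)=u$ if $u\neq0$ and $f(0)=q/2$; the pseudoweight of $(u_0,\ldots,u_{n-1})$ is $\sum_i f(u_i)$ computed in $\mathbb{Q}$. -}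

module Defs where

open import Data.Nat using (ℕ; zero; suc; _+_; _*_; _∸_; _≤_; NonZero)
open import Data.Nat.DivMod using (_mod_)
open import Data.Fin using (Fin; toℕ)
open import Data.Vec using (Vec; []; _∷_; tabulate; reverse; map; foldr)
open import Data.List using (List; concatMap; length; filter) renaming ([] to []ₗ; _∷_ to _∷ₗ_; map to mapₗ)
open import Data.List using (allFin)
open import Data.Integer using (+_)
open import Data.Rational using (ℚ; _/_; _≟_) renaming (_+_ to _+ℚ_)
open import Data.Product using (∃)
open import Relation.Binary.PropositionalEquality using (_≡_; _≢_)

-- A sequence over ℤ_q is a map ℕ → Fin q; Fin q is ℤ_q with residues 0..q-1.
Seq : ℕ → Set
Seq q = ℕ → Fin q

Periodic : ∀ {q} → Seq q → ℕ → Set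
Periodic s m = (1 ≤ m) × (∀ i → s (i + m) ≡ s i)
  where open import Data.Product using (_×_)

_≡_[mod_] : ℕ → ℕ → ℕ → Set
i ≡ j [mod m ] = ∃ λ a → ∃ λ b → i + a * m ≡ j + b * m

window : ∀ {q} → Seq q → (n : ℕ) → ℕ → Vec (Fin q) n
window s n i = tabulate (λ k → s (i + toℕ k))

negq : ∀ {q} .{{_ : NonZero q}} → Fin q → Fin q
negq {q} u = (q ∸ toℕ u) mod q

negT : ∀ {q n} .{{_ : NonZero q}} → Vec (Fin q) n → Vec (Fin q) n
negT = map negq

IsWindowSeq : ∀ {q} → (n : ℕ) → (m : ℕ) → Seq q → Set
IsWindowSeq n m s = Periodic s m × (∀ i j → window s n i ≡ window s n j → i ≡ j [mod m ])
  where open import Data.Product using (_×_)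

IsNegOrientable : ∀ {q} .{{_ : NonZero q}} → (n : ℕ) → (m : ℕ) → Seq q → Set
IsNegOrientable n m s =
  IsWindowSeq n m s × (∀ i j → window s n i ≢ negT (reverse (window s n j)))
  where open import Data.Product using (_×_)

fw : ∀ {q} → Fin q → ℚ
fw {q} Fin.zero = + q / 2
fw u = + toℕ u / 1

pseudoweight : ∀ {q n} → Vec (Fin q) n → ℚ
pseudoweight = foldr _ (λ u acc → fw u +ℚ acc) (+ 0 / 1)

allTuples : (q n : ℕ) → List (Vec (Fin q) n)
allTuples q zero = [] ∷ₗ []ₗ
allTuples q (suc n) = concatMap (λ u → mapₗ (u ∷_) (allTuples q n)) (allFin q)

r : (q n : ℕ) → ℚ → ℕ
r q n s = length (filter (λ v → pseudoweight v ≟ s) (allTuples q n))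

-- Write doubled u = 2 f(u). Every symbol has doubled (−u) + doubled u = 2q, so the doubled pseudoweight of −x^R
-- is 2nq minus that of x. Call x light if its doubled pseudoweight is below nq: a cyclic sequence all of whose
-- windows are light is negative orientable, since −x^R is heavy whenever x is light.
-- Such a sequence meeting every light tuple once per period is built by cycle joining, adding tuples in order of
-- weight. If a light tuple v is missing, rotate it to x so that a symbol u ≠ 1 comes first; replacing u by 1
-- (doubled 1 = 2 < doubled u) gives a lighter tuple, already on the cycle and with the same tail as x, so the
-- cycle of rotations of v, disjoint from the rotation-closed current cycle, can be spliced in there.
-- The period is then the number of light tuples, which x ↦ −x^R matches with the heavy ones; the remaining
-- r_{q,n,nq/2} tuples are those of pseudoweight exactly nq/2.

module Submission where

open import Defs
open import Data.Nat using (ℕ; _+_; _*_; _^_; _<_; _≥_; NonZero)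
open import Data.Integer using (+_)
open import Data.Rational using (_/_)
open import Data.Product using (∃; _×_)
open import Relation.Binary.PropositionalEquality using (_≡_)

open import Data.Nat as ℕ using (zero; suc; _∸_; _≤_; z≤n; s≤s; _%_; _<?_)
open import Data.Nat.Properties
open import Data.Nat.DivMod using (_mod_; n%n≡0; m≡m%n+[m/n]*n; [m+kn]%n≡m%n; m<n⇒m%n≡m; m%n<n; [m+n]%n≡m%n)
open import Data.Nat.Induction using (<-rec)
open import Data.Product using (_,_; proj₁; proj₂)
open import Data.Sum using (_⊎_; inj₁; inj₂; [_,_]′)
open import Data.Empty using (⊥-elim)
open import Relation.Binary.Definitions using (Tri; tri<; tri≈; tri>)
open import Relation.Nullary using (¬_; Dec; yes; no)
open import Relation.Unary using (Decidable)
open import Relation.Binary.PropositionalEquality using (_≢_; refl; sym; trans; cong; cong₂; subst; module ≡-Reasoning)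
open import Data.Fin as Fin using (Fin; toℕ; inject₁) renaming (zero to fzero; suc to fsuc)
open import Data.Fin.Properties using (all?; ¬∀⟶∃¬; toℕ-injective; toℕ-fromℕ<; toℕ-inject₁; toℕ<n)
open import Data.Vec as Vec using (Vec; []; _∷_; lookup)
open import Data.Vec.Properties using (lookup-replicate; ≡-dec; ∷-injectiveʳ; map-reverse; map-∘; map-cong; map-id; reverse-involutive; lookup∘tabulate; tabulate-cong; tabulate∘lookup; reverse-∷)
open import Data.Integer as ℤ using ()
open import Data.Integer.Properties using (pos-+; pos-*) renaming (+-injective to pos-injective)
open import Data.Rational using (toℚᵘ) renaming (_≟_ to _≟ℚ_)
open import Data.Rational.Properties using (toℚᵘ-homo-+; toℚᵘ-fromℚᵘ; toℚᵘ-injective; toℚᵘ-cong)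
open import Data.Rational.Unnormalised using (ℚᵘ; mkℚᵘ; *≡*) renaming (_+_ to _+ᵘ_; _≃_ to _≃ᵘ_)
open import Data.Rational.Unnormalised.Properties using () renaming (≃-trans to ≃ᵘ-trans; ≃-sym to ≃ᵘ-sym; +-cong to +ᵘ-cong)
open import Data.Nat.Solver using (module +-*-Solver)
open import Function.Base using (id; _∘_)
open import Function.Bundles using (_⇔_; mk⇔; Equivalence)
open import Data.List as List using (List; length; []) renaming (_∷_ to _∷ₗ_)
open import Data.List.Properties using (filter-≐; filter-accept; filter-reject; length-tabulate; length-++; length-map; length-applyUpTo)
open import Data.List.Membership.Propositional using (_∈_)
open import Data.List.Membership.Propositional.Properties using (∈-map⁻; ∈-map⁺; ∈-concatMap⁻; ∈-concatMap⁺; ∈-allFin; ∈-filter⁺; ∈-filter⁻; ∈-applyUpTo⁺; ∈-applyUpTo⁻)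
open import Data.List.Membership.Propositional.Properties.WithK using (unique∧set⇒bag)
open import Data.List.Relation.Unary.Any as Any using (here; there)
open import Data.List.Relation.Unary.All as All using ()
open import Data.List.Relation.Unary.AllPairs as AllPairs using ()
open import Data.List.Relation.Unary.Unique.Propositional using (Unique)
open import Data.List.Relation.Unary.Unique.Propositional.Properties using (++⁺; map⁺; filter⁺; allFin⁺; applyUpTo⁺₁)
open import Data.List.Relation.Binary.BagAndSetEquality using (∼bag⇒↭)
open import Data.List.Relation.Binary.Permutation.Propositional.Properties using (↭-length)
open import Algebra.Properties.CommutativeSemigroup +-commutativeSemigroup using (interchange; xy∙z≈xz∙y)

-- Periodic functions and residues

module _ {A : Set} where

  _HasPeriod_ : (ℕ → A) → ℕ → Set
  f HasPeriod p = ∀ t → f (t + p) ≡ f t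

  periodic-+* : ∀ {f p} → f HasPeriod p → ∀ a b → f (a + b * p) ≡ f a
  periodic-+* {f} {p} per a zero = cong f (+-identityʳ a)
  periodic-+* {f} {p} per a (suc b) = begin
      f (a + (p + b * p))  ≡⟨ cong f (trans (cong (λ x → a + x) (+-comm p (b * p))) (sym (+-assoc a (b * p) p))) ⟩
      f (a + b * p + p)    ≡⟨ per (a + b * p) ⟩
      f (a + b * p)        ≡⟨ periodic-+* per a b ⟩
      f a                  ∎
    where open ≡-Reasoning

  periodic-% : ∀ {f p} .{{_ : NonZero p}} → f HasPeriod p → ∀ t → f t ≡ f (t % p)
  periodic-% {f} {p} per t = trans (cong f (m≡m%n+[m/n]*n t p)) (periodic-+* per (t % p) (t ℕ./ p))

  periodic-shift : ∀ {f p} → f HasPeriod p → ∀ c → (λ u → f (c + u)) HasPeriod p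
  periodic-shift {f} {p} per c u = trans (cong f (sym (+-assoc c u p))) (per (c + u))

  periodic-attains : ∀ {f p} .{{_ : NonZero p}} → f HasPeriod p →
                     ∀ c t → ∃ λ s → s < p × f (c + s) ≡ f t
  periodic-attains {f} {p} per c t = d % p , m%n<n d p , (begin
      f (c + d % p)  ≡⟨ sym (periodic-% (periodic-shift per c) d) ⟩
      f (c + d)      ≡⟨ cong f (m+[n∸m]≡n c≤t+cp) ⟩
      f (t + c * p)  ≡⟨ periodic-+* per t c ⟩
      f t            ∎)
    where
      open ≡-Reasoning
      d = t + c * p ∸ c
      c≤t+cp : c ≤ t + c * p
      c≤t+cp = ≤-trans (m≤m*n c p) (m≤n+m (c * p) t)

≡[mod]-cancelˡ : ∀ c {a b m} → (c + a) ≡ (c + b) [mod m ] → a ≡ b [mod m ]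
≡[mod]-cancelˡ c {a} {b} {m} (x , y , e) =
  x , y , +-cancelˡ-≡ c _ _ (trans (sym (+-assoc c a (x * m))) (trans e (+-assoc c b (y * m))))

≡[mod]⇒≡ : ∀ {a b m} .{{_ : NonZero m}} → a < m → b < m → a ≡ b [mod m ] → a ≡ b
≡[mod]⇒≡ {a} {b} {m} a<m b<m (x , y , e) = begin
    a                ≡⟨ sym (m<n⇒m%n≡m a<m) ⟩
    a % m            ≡⟨ sym ([m+kn]%n≡m%n a x m) ⟩
    (a + x * m) % m  ≡⟨ cong (_% m) e ⟩
    (b + y * m) % m  ≡⟨ [m+kn]%n≡m%n b y m ⟩
    b % m            ≡⟨ m<n⇒m%n≡m b<m ⟩
    b                ∎
  where open ≡-Reasoning

%≡%⇒≡[mod] : ∀ {a b m} .{{_ : NonZero m}} → a % m ≡ b % m → a ≡ b [mod m ]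
%≡%⇒≡[mod] {a} {b} {m} e = b ℕ./ m , a ℕ./ m , (begin
    a + b ℕ./ m * m                       ≡⟨ cong (_+ b ℕ./ m * m) (m≡m%n+[m/n]*n a m) ⟩
    a % m + a ℕ./ m * m + b ℕ./ m * m     ≡⟨ +-assoc (a % m) _ _ ⟩
    a % m + (a ℕ./ m * m + b ℕ./ m * m)   ≡⟨ cong₂ _+_ e (+-comm (a ℕ./ m * m) _) ⟩
    b % m + (b ℕ./ m * m + a ℕ./ m * m)   ≡⟨ sym (+-assoc (b % m) _ _) ⟩
    b % m + b ℕ./ m * m + a ℕ./ m * m     ≡⟨ cong (_+ a ℕ./ m * m) (sym (m≡m%n+[m/n]*n b m)) ⟩
    b + a ℕ./ m * m                       ∎)
  where open ≡-Reasoning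

suc-% : ∀ t M .{{_ : NonZero M}} → suc t % M ≡ suc (t % M) % M
suc-% t M = trans (cong (λ x → suc x % M) (m≡m%n+[m/n]*n t M)) ([m+kn]%n≡m%n (suc (t % M)) (t ℕ./ M) M)

least-witness : ∀ {P : ℕ → Set} → Decidable P → ∀ {N} → P N → ∃ λ d → P d × (∀ e → e < d → ¬ P e)
least-witness {P} P? = <-rec (λ N → P N → Least) step _
  where
    Least : Set
    Least = ∃ λ d → P d × (∀ e → e < d → ¬ P e)
    step : ∀ N → (∀ {M} → M < N → P M → Least) → P N → Least
    step N rec pN with anyUpTo? P? N
    ... | yes (M , M<N , pM) = rec M<N pM
    ... | no none = N , pN , λ e e<N pe → none (e , e<N , pe)

-- Weights, windows and rotations

module _ {A : Set} where

  weight : ∀ {k} → (A → ℕ) → Vec A k → ℕ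
  weight w [] = 0
  weight w (x ∷ xs) = w x + weight w xs

  weight-∷ʳ : ∀ {k} (w : A → ℕ) (xs : Vec A k) x → weight w (xs Vec.∷ʳ x) ≡ weight w xs + w x
  weight-∷ʳ w [] x = +-comm (w x) 0
  weight-∷ʳ w (y ∷ ys) x = trans (cong (λ z → w y + z) (weight-∷ʳ w ys x)) (sym (+-assoc (w y) (weight w ys) (w x)))

  weight-reverse : ∀ {k} (w : A → ℕ) (xs : Vec A k) → weight w (Vec.reverse xs) ≡ weight w xs
  weight-reverse w [] = refl
  weight-reverse w (x ∷ xs) = begin
      weight w (Vec.reverse (x ∷ xs))     ≡⟨ cong (weight w) (reverse-∷ x xs) ⟩
      weight w (Vec.reverse xs Vec.∷ʳ x)  ≡⟨ weight-∷ʳ w (Vec.reverse xs) x ⟩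
      weight w (Vec.reverse xs) + w x     ≡⟨ cong (_+ w x) (weight-reverse w xs) ⟩
      weight w xs + w x                   ≡⟨ +-comm (weight w xs) (w x) ⟩
      w x + weight w xs                   ∎
    where open ≡-Reasoning

  weight-map-complement : ∀ {k} (w : A → ℕ) (g : A → A) {c} → (∀ x → w (g x) + w x ≡ c) →
                          ∀ (xs : Vec A k) → weight w (Vec.map g xs) + weight w xs ≡ k * c
  weight-map-complement w g compl [] = refl
  weight-map-complement {suc k} w g {c} compl (x ∷ xs) = begin
      w (g x) + weight w (Vec.map g xs) + (w x + weight w xs)  ≡⟨ interchange (w (g x)) _ (w x) _ ⟩
      w (g x) + w x + (weight w (Vec.map g xs) + weight w xs)  ≡⟨ cong₂ _+_ (compl x) (weight-map-complement w g compl xs) ⟩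
      c + k * c                                                ∎
    where open ≡-Reasoning

module _ {q : ℕ} where

  lookup-window : ∀ (X : Seq q) k t (i : Fin k) → lookup (window X k t) i ≡ X (t + toℕ i)
  lookup-window X k t i = lookup∘tabulate (λ j → X (t + toℕ j)) i

  window-cong : ∀ (X Y : Seq q) {k} a b → (∀ (i : Fin k) → X (a + toℕ i) ≡ Y (b + toℕ i)) →
                window X k a ≡ window Y k b
  window-cong X Y a b = tabulate-cong

  window-suc : ∀ (X : Seq q) k a → window X (suc k) a ≡ X a ∷ window X k (suc a)
  window-suc X k a = cong₂ _∷_ (cong X (+-identityʳ a)) (tabulate-cong (λ i → cong X (+-suc a (toℕ i))))

  window-periodic : ∀ {X : Seq q} {p} → X HasPeriod p → ∀ k → window X k HasPeriod p
  window-periodic {X} {p} per k t = window-cong X X (t + p) t λ i → begin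
      X (t + p + toℕ i)  ≡⟨ cong X (xy∙z≈xz∙y t p (toℕ i)) ⟩
      X (t + toℕ i + p)  ≡⟨ per (t + toℕ i) ⟩
      X (t + toℕ i)      ∎
    where open ≡-Reasoning

  module _ (w : Fin q → ℕ) (X : Seq q) where

    weight-window-slide : ∀ k a → w (X a) + weight w (window X k (suc a)) ≡ weight w (window X k a) + w (X (a + k))
    weight-window-slide zero a = trans (+-comm (w (X a)) 0) (cong (λ i → w (X i)) (sym (+-identityʳ a)))
    weight-window-slide (suc k) a = begin
        w (X a) + weight w (window X (suc k) (suc a))                    ≡⟨ cong (λ v → w (X a) + weight w v) (window-suc X k (suc a)) ⟩
        w (X a) + (w (X (suc a)) + weight w (window X k (suc (suc a))))  ≡⟨ cong (λ x → w (X a) + x) (weight-window-slide k (suc a)) ⟩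
        w (X a) + (weight w (window X k (suc a)) + w (X (suc a + k)))    ≡⟨ sym (+-assoc (w (X a)) _ _) ⟩
        w (X a) + weight w (window X k (suc a)) + w (X (suc a + k))      ≡⟨ cong₂ _+_ (cong (weight w) (sym (window-suc X k a)))
                                                                                       (cong (λ i → w (X i)) (sym (+-suc a k))) ⟩
        weight w (window X (suc k) a) + w (X (a + suc k))                ∎
      where open ≡-Reasoning

    weight-window-periodic : ∀ {k} → X HasPeriod k → ∀ a → weight w (window X k a) ≡ weight w (window X k 0)
    weight-window-periodic per zero = refl
    weight-window-periodic {k} per (suc a) = trans slide (weight-window-periodic per a)
      where
        slide : weight w (window X k (suc a)) ≡ weight w (window X k a)
        slide = +-cancelˡ-≡ (w (X a)) _ _ (trans (weight-window-slide k a)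
                  (trans (cong (λ u → weight w (window X k a) + w u) (per a)) (+-comm _ (w (X a)))))

  record _↝_ {k} (u v : Vec (Fin q) (suc k)) : Set where
    constructor overlapping
    field shift-agrees : ∀ (i : Fin k) → lookup u (fsuc i) ≡ lookup v (inject₁ i)

  open _↝_ public

  window-↝ : ∀ (X : Seq q) k t → window X (suc k) t ↝ window X (suc k) (suc t)
  window-↝ X k t = overlapping λ i → begin
      lookup (window X (suc k) t) (fsuc i)              ≡⟨ lookup-window X (suc k) t (fsuc i) ⟩
      X (t + suc (toℕ i))                               ≡⟨ cong X (+-suc t (toℕ i)) ⟩
      X (suc t + toℕ i)                                 ≡⟨ cong (λ x → X (suc t + x)) (sym (toℕ-inject₁ i)) ⟩
      X (suc t + toℕ (inject₁ i))                       ≡⟨ sym (lookup-window X (suc k) (suc t) (inject₁ i)) ⟩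
      lookup (window X (suc k) (suc t)) (inject₁ i)     ∎
    where open ≡-Reasoning

  ↝-cong : ∀ {k} {u u' v v' : Vec (Fin q) (suc k)} → u ≡ u' → v ≡ v' → u ↝ v → u' ↝ v'
  ↝-cong refl refl u↝v = u↝v

  ↝-tail : ∀ {k} {u u' v : Vec (Fin q) (suc k)} → Vec.tail u ≡ Vec.tail u' → u ↝ v → u' ↝ v
  ↝-tail {u = _ ∷ _} {_ ∷ _} refl u↝v = overlapping (shift-agrees u↝v)

  ↝-wrap : ∀ M .{{_ : NonZero M}} {k} (G : ℕ → Vec (Fin q) (suc k)) →
           (∀ s → suc s < M → G s ↝ G (suc s)) → (∀ s → suc s ≡ M → G s ↝ G 0) →
           ∀ t → G (t % M) ↝ G (suc t % M)
  ↝-wrap M G inner last t with m≤n⇒m<n∨m≡n (m%n<n t M)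
  ... | inj₁ lt = subst (λ s → G (t % M) ↝ G s) (sym (trans (suc-% t M) (m<n⇒m%n≡m lt))) (inner (t % M) lt)
  ... | inj₂ eq = subst (λ s → G (t % M) ↝ G s) (sym (trans (suc-% t M) (trans (cong (_% M) eq) (n%n≡0 M)))) (last (t % M) eq)

  module _ {k} (V : ℕ → Vec (Fin q) (suc k)) (V↝ : ∀ t → V t ↝ V (suc t)) where

    heads : Seq q
    heads t = lookup (V t) fzero

    private
      -- Indexed by j = toℕ i: the recursion goes from fsuc i to inject₁ i, which is not a subterm.
      lookup-heads : ∀ j t (i : Fin (suc k)) → toℕ i ≡ j → lookup (V t) i ≡ heads (t + j)
      lookup-heads zero t fzero _ = cong heads (sym (+-identityʳ t))
      lookup-heads (suc j) t (fsuc i) e = begin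
          lookup (V t) (fsuc i)           ≡⟨ shift-agrees (V↝ t) i ⟩
          lookup (V (suc t)) (inject₁ i)  ≡⟨ lookup-heads j (suc t) (inject₁ i) (trans (toℕ-inject₁ i) (suc-injective e)) ⟩
          heads (suc t + j)               ≡⟨ cong heads (sym (+-suc t j)) ⟩
          heads (t + suc j)               ∎
        where open ≡-Reasoning

    window-heads : ∀ t → window heads (suc k) t ≡ V t
    window-heads t = trans (tabulate-cong (λ i → sym (lookup-heads (toℕ i) t i refl))) (tabulate∘lookup (V t))

module Rotation {q : ℕ} (n' : ℕ) where

  n : ℕ
  n = suc n'

  Tuple : Set
  Tuple = Vec (Fin q) n

  cyclic : Tuple → Seq q
  cyclic y t = lookup y (t mod n)

  rotate : Tuple → ℕ → Tuple
  rotate y = window (cyclic y) n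

  private
    toℕ-mod : ∀ t → toℕ (t mod n) ≡ t % n
    toℕ-mod t = toℕ-fromℕ< (m%n<n t n)

  cyclic-periodic : ∀ y → cyclic y HasPeriod n
  cyclic-periodic y t = cong (lookup y) (toℕ-injective (begin
      toℕ ((t + n) mod n)  ≡⟨ toℕ-mod (t + n) ⟩
      (t + n) % n          ≡⟨ [m+n]%n≡m%n t n ⟩
      t % n                ≡⟨ sym (toℕ-mod t) ⟩
      toℕ (t mod n)        ∎))
    where open ≡-Reasoning

  cyclic-toℕ : ∀ y (i : Fin n) → cyclic y (toℕ i) ≡ lookup y i
  cyclic-toℕ y i = cong (lookup y) (toℕ-injective (trans (toℕ-mod (toℕ i)) (m<n⇒m%n≡m (toℕ<n i))))

  rotate-0 : ∀ y → rotate y 0 ≡ y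
  rotate-0 y = trans (tabulate-cong (cyclic-toℕ y)) (tabulate∘lookup y)

  rotate-window : ∀ {X : Seq q} → X HasPeriod n → ∀ a b → rotate (window X n a) b ≡ window X n (a + b)
  rotate-window {X} per a b = window-cong (cyclic (window X n a)) X b (a + b) λ i → begin
      cyclic (window X n a) (b + toℕ i)    ≡⟨ lookup-window X n a ((b + toℕ i) mod n) ⟩
      X (a + toℕ ((b + toℕ i) mod n))      ≡⟨ cong (λ j → X (a + j)) (toℕ-mod (b + toℕ i)) ⟩
      X (a + (b + toℕ i) % n)              ≡⟨ sym (periodic-% (periodic-shift per a) (b + toℕ i)) ⟩
      X (a + (b + toℕ i))                  ≡⟨ cong X (sym (+-assoc a b (toℕ i))) ⟩
      X (a + b + toℕ i)                    ∎
    where open ≡-Reasoning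

  rotate-rotate : ∀ y a b → rotate (rotate y a) b ≡ rotate y (a + b)
  rotate-rotate y = rotate-window (cyclic-periodic y)

  rotate-periodic : ∀ y → rotate y HasPeriod n
  rotate-periodic y = window-periodic (cyclic-periodic y) n

  rotate-inverse : ∀ y a → rotate (rotate y a) (a * n') ≡ y
  rotate-inverse y a = begin
      rotate (rotate y a) (a * n')  ≡⟨ rotate-rotate y a (a * n') ⟩
      rotate y (a + a * n')         ≡⟨ cong (rotate y) (sym (*-suc a n')) ⟩
      rotate y (0 + a * n)          ≡⟨ periodic-+* (rotate-periodic y) 0 a ⟩
      rotate y 0                    ≡⟨ rotate-0 y ⟩
      y                             ∎
    where open ≡-Reasoning

  weight-rotate : ∀ (w : Fin q → ℕ) y a → weight w (rotate y a) ≡ weight w y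
  weight-rotate w y a = trans (weight-window-periodic w (cyclic y) (cyclic-periodic y) a) (cong (weight w) (rotate-0 y))

  rotate-cancel : ∀ x {a b} → a ≤ b → rotate x a ≡ rotate x b → rotate x (b ∸ a) ≡ x
  rotate-cancel x {a} {b} a≤b e = begin
      rotate x (b ∸ a)              ≡⟨ sym (periodic-+* (rotate-periodic x) (b ∸ a) a) ⟩
      rotate x (b ∸ a + a * n)      ≡⟨ cong (rotate x) exponent ⟩
      rotate x (b + a * n')         ≡⟨ sym (rotate-rotate x b (a * n')) ⟩
      rotate (rotate x b) (a * n')  ≡⟨ cong (λ y → rotate y (a * n')) (sym e) ⟩
      rotate (rotate x a) (a * n')  ≡⟨ rotate-inverse x a ⟩
      x                             ∎
    where
      open ≡-Reasoning
      exponent : b ∸ a + a * n ≡ b + a * n'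
      exponent = trans (cong (λ z → b ∸ a + z) (*-suc a n'))
                   (trans (sym (+-assoc (b ∸ a) a (a * n'))) (cong (_+ a * n') (m∸n+n≡m a≤b)))

-- Cycle joining

module Cycles {q : ℕ} (n' : ℕ) (Allowed : Vec (Fin q) (suc n') → Set) where

  open Rotation {q} n'

  record Cycle : Set where
    field
      pred-period     : ℕ
      state           : ℕ → Tuple
      state-periodic  : state HasPeriod suc pred-period
      state-↝         : ∀ t → state t ↝ state (suc t)
      state-injective : ∀ a b → state a ≡ state b → a ≡ b [mod suc pred-period ]
      state-allowed   : ∀ t → Allowed (state t)
      rotation-closed : ∀ t a → ∃ λ t' → state t' ≡ rotate (state t) a

    period : ℕ
    period = suc pred-period

  open Cycle public

  _∈ᶜ_ : Tuple → Cycle → Set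
  v ∈ᶜ C = ∃ λ t → state C t ≡ v

  _⊆ᶜ_ : Cycle → Cycle → Set
  C ⊆ᶜ D = ∀ {v} → v ∈ᶜ C → v ∈ᶜ D

  _∈ᶜ?_ : ∀ v C → Dec (v ∈ᶜ C)
  v ∈ᶜ? C with anyUpTo? (λ t → ≡-dec Fin._≟_ (state C t) v) (period C)
  ... | yes (t , _ , e) = yes (t , e)
  ... | no none = no λ (t , e) → none (t % period C , m%n<n t (period C) , trans (sym (periodic-% (state-periodic C) t)) e)

  module _ (x : Tuple) where

    private
      Returns : ℕ → Set
      Returns d = rotate x (suc d) ≡ x

      returns-after-n : Returns n'
      returns-after-n = trans (rotate-periodic x 0) (rotate-0 x)

      first-return : ∃ λ d → Returns d × (∀ e → e < d → ¬ Returns e)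
      first-return = least-witness (λ d → ≡-dec Fin._≟_ (rotate x (suc d)) x) returns-after-n

      d : ℕ
      d = proj₁ first-return

      rotate-periodic-d : rotate x HasPeriod suc d
      rotate-periodic-d t = begin
          rotate x (t + suc d)            ≡⟨ cong (rotate x) (+-comm t (suc d)) ⟩
          rotate x (suc d + t)            ≡⟨ sym (rotate-rotate x (suc d) t) ⟩
          rotate (rotate x (suc d)) t     ≡⟨ cong (λ y → rotate y t) (proj₁ (proj₂ first-return)) ⟩
          rotate x t                      ∎
        where open ≡-Reasoning

      no-early-return : ∀ {a b} → a < b → b < suc d → rotate x a ≢ rotate x b
      no-early-return {a} {b} a<b b<p e with b ∸ a in b∸a | rotate-cancel x (<⇒≤ a<b) e
      ... | zero    | _       = <-irrefl (sym b∸a) (m<n⇒0<n∸m a<b)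
      ... | suc e′  | returns = proj₂ (proj₂ first-return) e′ e′<d returns
        where e′<d : e′ < d
              e′<d = ℕ.s≤s⁻¹ (≤-<-trans (subst (_≤ b) b∸a (m∸n≤m b a)) b<p)

      rotate-injective : ∀ a b → a < suc d → b < suc d → rotate x a ≡ rotate x b → a ≡ b
      rotate-injective a b a<p b<p e with <-cmp a b
      ... | tri< lt _ _ = ⊥-elim (no-early-return lt b<p e)
      ... | tri≈ _ eq _ = eq
      ... | tri> _ _ gt = ⊥-elim (no-early-return gt a<p (sym e))

    rotationCycle : (∀ a → Allowed (rotate x a)) → Cycle
    rotationCycle allowed = record
      { pred-period     = d
      ; state           = rotate x
      ; state-periodic  = rotate-periodic-d
      ; state-↝         = window-↝ (cyclic x) n'
      ; state-injective = λ a b e → %≡%⇒≡[mod] (rotate-injective (a % suc d) (b % suc d) (m%n<n a (suc d)) (m%n<n b (suc d))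
                            (trans (sym (periodic-% rotate-periodic-d a)) (trans e (periodic-% rotate-periodic-d b))))
      ; state-allowed   = allowed
      ; rotation-closed = λ t a → t + a , sym (rotate-rotate x t a)
      }

  -- As state C i and state D j have the same tail, they have the same successors: the joined walk leaves C
  -- after state C i for state D (suc j), runs once around D and returns from state D j to state C (suc i).
  module Join (C D : Cycle) (i j : ℕ) (disjoint : ∀ s t → state C s ≢ state D t)
              (same-tail : Vec.tail (state C i) ≡ Vec.tail (state D j)) where

    private
      m p M : ℕ
      m = period C
      p = period D
      M = m + p

      path : ℕ → Tuple
      path s with s <? m
      ... | yes _ = state C (suc i + s)
      ... | no _  = state D (suc j + (s ∸ m))

      path-C : ∀ {s} → s < m → path s ≡ state C (suc i + s)
      path-C {s} s<m with s <? m
      ... | yes _ = refl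
      ... | no s≮m = ⊥-elim (s≮m s<m)

      path-D : ∀ {s} → m ≤ s → path s ≡ state D (suc j + (s ∸ m))
      path-D {s} m≤s with s <? m
      ... | yes s<m = ⊥-elim (<⇒≱ s<m m≤s)
      ... | no _ = refl

      within-C : ∀ {s} → suc s < m → path s ↝ path (suc s)
      within-C {s} s+1<m = ↝-cong (sym (path-C (<-trans (n<1+n s) s+1<m)))
        (sym (trans (path-C s+1<m) (cong (state C) (+-suc (suc i) s)))) (state-↝ C (suc i + s))

      within-D : ∀ {s} → m ≤ s → path s ↝ path (suc s)
      within-D {s} m≤s = ↝-cong (sym (path-D m≤s)) (sym (trans (path-D (m≤n⇒m≤1+n m≤s)) (cong (state D) index)))
        (state-↝ D (suc j + (s ∸ m)))
        where index : suc j + (suc s ∸ m) ≡ suc (suc j + (s ∸ m))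
              index = trans (cong (λ x → suc j + x) (+-∸-assoc 1 m≤s)) (+-suc (suc j) (s ∸ m))

      C-to-D : ∀ {s} → suc s ≡ m → path s ↝ path (suc s)
      C-to-D {s} s+1≡m = ↝-cong (sym leave-C) (sym enter-D) (↝-tail (sym same-tail) (state-↝ D j))
        where
          leave-C : path s ≡ state C i
          leave-C = trans (path-C (≤-reflexive s+1≡m))
            (trans (cong (state C) (sym (+-suc i s))) (trans (cong (λ x → state C (i + x)) s+1≡m) (state-periodic C i)))
          enter-D : path (suc s) ≡ state D (suc j)
          enter-D = trans (path-D (≤-reflexive (sym s+1≡m)))
            (cong (state D) (trans (cong (λ x → suc j + x) (trans (cong (_∸ m) s+1≡m) (n∸n≡0 m))) (+-identityʳ (suc j))))

      D-to-C : ∀ s → suc s ≡ M → path s ↝ path 0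
      D-to-C s s+1≡M = ↝-cong (sym leave-D) (sym enter-C) (↝-tail same-tail (state-↝ C i))
        where
          s≡ : s ≡ m + pred-period D
          s≡ = suc-injective (trans s+1≡M (+-suc m (pred-period D)))
          m≤s : m ≤ s
          m≤s = subst (m ≤_) (sym s≡) (m≤m+n m (pred-period D))
          leave-D : path s ≡ state D j
          leave-D = trans (path-D m≤s) (trans (cong (λ x → state D (suc j + x)) (trans (cong (_∸ m) s≡) (m+n∸m≡n m (pred-period D))))
            (trans (cong (state D) (sym (+-suc j (pred-period D)))) (state-periodic D j)))
          enter-C : path 0 ≡ state C (suc i)
          enter-C = trans (path-C (s≤s z≤n)) (cong (state C) (+-identityʳ (suc i)))

      path-↝ : ∀ s → suc s < M → path s ↝ path (suc s)
      path-↝ s _ with <-cmp (suc s) m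
      ... | tri< s+1<m _ _ = within-C s+1<m
      ... | tri≈ _ s+1≡m _ = C-to-D s+1≡m
      ... | tri> _ _ m<s+1 = within-D (ℕ.s≤s⁻¹ m<s+1)

      offset-< : ∀ {s} → m ≤ s → s < M → s ∸ m < p
      offset-< {s} m≤s s<M = +-cancelˡ-< m (s ∸ m) p (subst (_< M) (sym (m+[n∸m]≡n m≤s)) s<M)

      path-injective : ∀ {s s'} → s < M → s' < M → path s ≡ path s' → Dec (s < m) → Dec (s' < m) → s ≡ s'
      path-injective {s} {s'} _ _ e (yes s<m) (yes s'<m) =
        ≡[mod]⇒≡ s<m s'<m (≡[mod]-cancelˡ (suc i) (state-injective C _ _ (trans (sym (path-C s<m)) (trans e (path-C s'<m)))))
      path-injective _ _ e (yes s<m) (no s'≮m) =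
        ⊥-elim (disjoint _ _ (trans (sym (path-C s<m)) (trans e (path-D (≮⇒≥ s'≮m)))))
      path-injective _ _ e (no s≮m) (yes s'<m) =
        ⊥-elim (disjoint _ _ (trans (sym (path-C s'<m)) (trans (sym e) (path-D (≮⇒≥ s≮m)))))
      path-injective {s} {s'} s<M s'<M e (no s≮m) (no s'≮m) = ∸-cancelʳ-≡ m≤s m≤s'
        (≡[mod]⇒≡ (offset-< m≤s s<M) (offset-< m≤s' s'<M)
          (≡[mod]-cancelˡ (suc j) (state-injective D _ _ (trans (sym (path-D m≤s)) (trans e (path-D m≤s'))))))
        where m≤s = ≮⇒≥ s≮m
              m≤s' = ≮⇒≥ s'≮m

      path-in : ∀ s → path s ∈ᶜ C ⊎ path s ∈ᶜ D
      path-in s with s <? m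
      ... | yes _ = inj₁ (suc i + s , refl)
      ... | no _  = inj₂ (suc j + (s ∸ m) , refl)

      joined-state : ℕ → Tuple
      joined-state t = path (t % M)

      joined-state-small : ∀ {s} → s < M → joined-state s ≡ path s
      joined-state-small s<M = cong path (m<n⇒m%n≡m s<M)

    C⊆joined : ∀ {v} → v ∈ᶜ C → ∃ λ t → joined-state t ≡ v
    C⊆joined (t , refl) with periodic-attains (state-periodic C) (suc i) t
    ... | s , s<m , e = s , trans (joined-state-small (<-≤-trans s<m (m≤m+n m p))) (trans (path-C s<m) e)

    D⊆joined : ∀ {v} → v ∈ᶜ D → ∃ λ t → joined-state t ≡ v
    D⊆joined (t , refl) with periodic-attains (state-periodic D) (suc j) t
    ... | s , s<p , e = m + s , trans (joined-state-small (+-monoʳ-< m s<p))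
                                  (trans (path-D (m≤m+n m s)) (trans (cong (λ x → state D (suc j + x)) (m+n∸m≡n m s)) e))

    joined : Cycle
    joined = record
      { pred-period     = pred-period C + p
      ; state           = joined-state
      ; state-periodic  = λ t → cong path ([m+n]%n≡m%n t M)
      ; state-↝         = ↝-wrap M path path-↝ D-to-C
      ; state-injective = λ a b e → %≡%⇒≡[mod] (path-injective (m%n<n a M) (m%n<n b M) e ((a % M) <? m) ((b % M) <? m))
      ; state-allowed   = λ t → allowed (path-in (t % M))
      ; rotation-closed = λ t a → closed (path-in (t % M)) a
      }
      where
        allowed : ∀ {v} → v ∈ᶜ C ⊎ v ∈ᶜ D → Allowed v
        allowed (inj₁ (t , refl)) = state-allowed C t
        allowed (inj₂ (t , refl)) = state-allowed D t
        closed : ∀ {v} → v ∈ᶜ C ⊎ v ∈ᶜ D → ∀ a → ∃ λ t' → joined-state t' ≡ rotate v a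
        closed (inj₁ (t , refl)) a = C⊆joined (rotation-closed C t a)
        closed (inj₂ (t , refl)) a = D⊆joined (rotation-closed D t a)

-- The doubled pseudoweight

module _ {q₁ : ℕ} where

  private
    q : ℕ
    q = suc q₁

  doubled : Fin q → ℕ
  doubled fzero = q
  doubled (fsuc u) = 2 * suc (toℕ u)

  private
    toℕ-negq : ∀ (u : Fin q) → toℕ (negq u) ≡ (q ∸ toℕ u) % q
    toℕ-negq u = toℕ-fromℕ< (m%n<n (q ∸ toℕ u) q)

    toℕ-negq-0 : toℕ (negq {q} fzero) ≡ 0
    toℕ-negq-0 = trans (toℕ-negq fzero) (n%n≡0 q)

    toℕ-negq-suc : ∀ (u : Fin q₁) → toℕ (negq {q} (fsuc u)) ≡ q ∸ suc (toℕ u)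
    toℕ-negq-suc u = trans (toℕ-negq (fsuc u)) (m<n⇒m%n≡m (∸-monoʳ-< (s≤s z≤n) (<⇒≤ (toℕ<n (fsuc u)))))

  doubled-negq : ∀ u → doubled (negq u) + doubled u ≡ 2 * q
  doubled-negq fzero with negq {q} fzero | toℕ-negq-0
  ... | fzero  | _ = cong (λ x → q + x) (sym (+-identityʳ q))
  ... | fsuc _ | ()
  doubled-negq (fsuc u) with negq {q} (fsuc u) | toℕ-negq-suc u
  ... | fzero  | e = ⊥-elim (<-irrefl e (m<n⇒0<n∸m (toℕ<n (fsuc u))))
  ... | fsuc v | e = begin
      2 * suc (toℕ v) + 2 * suc (toℕ u)    ≡⟨ sym (*-distribˡ-+ 2 (suc (toℕ v)) (suc (toℕ u))) ⟩
      2 * (suc (toℕ v) + suc (toℕ u))      ≡⟨ cong (λ x → 2 * (x + suc (toℕ u))) e ⟩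
      2 * (q ∸ suc (toℕ u) + suc (toℕ u))  ≡⟨ cong (2 *_) (m∸n+n≡m (<⇒≤ (toℕ<n (fsuc u)))) ⟩
      2 * q                                ∎
    where open ≡-Reasoning

  negq-involutive : ∀ (u : Fin q) → negq (negq u) ≡ u
  negq-involutive fzero = toℕ-injective (begin
      toℕ (negq (negq fzero))         ≡⟨ toℕ-negq (negq fzero) ⟩
      (q ∸ toℕ (negq {q} fzero)) % q  ≡⟨ cong (λ x → (q ∸ x) % q) toℕ-negq-0 ⟩
      q % q                           ≡⟨ n%n≡0 q ⟩
      0                               ∎)
    where open ≡-Reasoning
  negq-involutive (fsuc u) = toℕ-injective (begin
      toℕ (negq (negq (fsuc u)))          ≡⟨ toℕ-negq (negq (fsuc u)) ⟩
      (q ∸ toℕ (negq {q} (fsuc u))) % q   ≡⟨ cong (λ x → (q ∸ x) % q) (toℕ-negq-suc u) ⟩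
      (q ∸ (q ∸ suc (toℕ u))) % q         ≡⟨ cong (_% q) (m∸[m∸n]≡n (<⇒≤ (toℕ<n (fsuc u)))) ⟩
      suc (toℕ u) % q                     ≡⟨ m<n⇒m%n≡m (toℕ<n (fsuc u)) ⟩
      suc (toℕ u)                         ∎)
    where open ≡-Reasoning

  negRev : ∀ {k} → Vec (Fin q) k → Vec (Fin q) k
  negRev v = negT (Vec.reverse v)

  doubled-negRev : ∀ {k} (v : Vec (Fin q) k) → weight doubled (negRev v) + weight doubled v ≡ k * (2 * q)
  doubled-negRev {k} v = begin
      weight doubled (negRev v) + weight doubled v                 ≡⟨ cong (λ z → weight doubled (negRev v) + z)
                                                                           (sym (weight-reverse doubled v)) ⟩
      weight doubled (negRev v) + weight doubled (Vec.reverse v)   ≡⟨ weight-map-complement doubled negq doubled-negq (Vec.reverse v) ⟩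
      k * (2 * q)                                                  ∎
    where open ≡-Reasoning

  negRev-involutive : ∀ {k} (v : Vec (Fin q) k) → negRev (negRev v) ≡ v
  negRev-involutive v = begin
      Vec.map negq (Vec.reverse (Vec.map negq (Vec.reverse v)))  ≡⟨ map-reverse negq (Vec.map negq (Vec.reverse v)) ⟩
      Vec.reverse (Vec.map negq (Vec.map negq (Vec.reverse v)))  ≡⟨ cong Vec.reverse (sym (map-∘ negq negq (Vec.reverse v))) ⟩
      Vec.reverse (Vec.map (negq ∘ negq) (Vec.reverse v))       ≡⟨ cong Vec.reverse (map-cong negq-involutive (Vec.reverse v)) ⟩
      Vec.reverse (Vec.map id (Vec.reverse v))                  ≡⟨ cong Vec.reverse (map-id (Vec.reverse v)) ⟩
      Vec.reverse (Vec.reverse v)                               ≡⟨ reverse-involutive v ⟩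
      v                                                         ∎
    where open ≡-Reasoning

  private
    halfᵘ : ℕ → ℚᵘ
    halfᵘ a = mkℚᵘ (+ a) 1

    halfᵘ-+ : ∀ a b → halfᵘ a +ᵘ halfᵘ b ≃ᵘ halfᵘ (a + b)
    halfᵘ-+ a b = *≡* (begin
        (+ a ℤ.* + 2 ℤ.+ + b ℤ.* + 2) ℤ.* + 2  ≡⟨ cong (λ x → x ℤ.* + 2) (cong₂ ℤ._+_ (sym (pos-* a 2)) (sym (pos-* b 2))) ⟩
        (+ (a * 2) ℤ.+ + (b * 2)) ℤ.* + 2      ≡⟨ cong (λ x → x ℤ.* + 2) (sym (pos-+ (a * 2) (b * 2))) ⟩
        + (a * 2 + b * 2) ℤ.* + 2              ≡⟨ sym (pos-* (a * 2 + b * 2) 2) ⟩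
        + ((a * 2 + b * 2) * 2)                ≡⟨ cong +_ (solve 2 (λ a b → (a :* con 2 :+ b :* con 2) :* con 2 := (a :+ b) :* con 4)
                                                                   refl a b) ⟩
        + ((a + b) * 4)                        ≡⟨ pos-* (a + b) 4 ⟩
        + (a + b) ℤ.* + 4                      ∎)
      where open ≡-Reasoning
            open +-*-Solver

    halfᵘ-injective : ∀ a b → halfᵘ a ≃ᵘ halfᵘ b → a ≡ b
    halfᵘ-injective a b (*≡* e) = *-cancelʳ-≡ a b 2 (pos-injective (trans (pos-* a 2) (trans e (sym (pos-* b 2)))))

    fw-doubled : ∀ (u : Fin q) → toℚᵘ (fw u) ≃ᵘ halfᵘ (doubled u)
    fw-doubled fzero = toℚᵘ-fromℚᵘ (halfᵘ q)
    fw-doubled (fsuc u) = ≃ᵘ-trans (toℚᵘ-fromℚᵘ (mkℚᵘ (+ suc (toℕ u)) 0))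
      (*≡* (trans (sym (pos-* (suc (toℕ u)) 2))
             (trans (cong +_ (trans (*-comm (suc (toℕ u)) 2) (sym (*-identityʳ _)))) (pos-* (2 * suc (toℕ u)) 1))))

    pseudoweight-doubled : ∀ {k} (v : Vec (Fin q) k) → toℚᵘ (pseudoweight v) ≃ᵘ halfᵘ (weight doubled v)
    pseudoweight-doubled [] = ≃ᵘ-trans (toℚᵘ-fromℚᵘ (mkℚᵘ (+ 0) 0)) (*≡* refl)
    pseudoweight-doubled (u ∷ v) = ≃ᵘ-trans (toℚᵘ-homo-+ (fw u) (pseudoweight v))
      (≃ᵘ-trans (+ᵘ-cong (fw-doubled u) (pseudoweight-doubled v)) (halfᵘ-+ (doubled u) (weight doubled v)))

  pseudoweight≡half⇔ : ∀ {k} (v : Vec (Fin q) k) N → pseudoweight v ≡ + N / 2 ⇔ weight doubled v ≡ N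
  pseudoweight≡half⇔ v N = mk⇔
    (λ e → halfᵘ-injective _ N
             (≃ᵘ-trans (≃ᵘ-sym (pseudoweight-doubled v)) (≃ᵘ-trans (toℚᵘ-cong e) (toℚᵘ-fromℚᵘ (halfᵘ N)))))
    (λ { refl → toℚᵘ-injective (≃ᵘ-trans (pseudoweight-doubled v) (≃ᵘ-sym (toℚᵘ-fromℚᵘ (halfᵘ (weight doubled v))))) })

-- Counting tuples

length-unique-≡ : ∀ {A : Set} {xs ys : List A} → Unique xs → Unique ys →
                  (∀ {x} → x ∈ xs → x ∈ ys) → (∀ {x} → x ∈ ys → x ∈ xs) → length xs ≡ length ys
length-unique-≡ xs! ys! xs⊆ys ys⊆xs = ↭-length (∼bag⇒↭ (unique∧set⇒bag xs! ys! (mk⇔ xs⊆ys ys⊆xs)))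

length-filter-Tri : ∀ {A : Set} {P Q R : A → Set} (P? : Decidable P) (Q? : Decidable Q) (R? : Decidable R) →
                    (∀ x → Tri (P x) (Q x) (R x)) → ∀ xs →
                    length (List.filter P? xs) + length (List.filter Q? xs) + length (List.filter R? xs) ≡ length xs
length-filter-Tri P? Q? R? tri [] = refl
length-filter-Tri {P = P} {Q} {R} P? Q? R? tri (x ∷ₗ xs) = by-cases (tri x)
  where
    ih = length-filter-Tri P? Q? R? tri xs
    F : ∀ {S : _ → Set} → Decidable S → ℕ
    F S? = length (List.filter S? (x ∷ₗ xs))
    by : ∀ {a b c} → List.filter P? (x ∷ₗ xs) ≡ a → List.filter Q? (x ∷ₗ xs) ≡ b → List.filter R? (x ∷ₗ xs) ≡ c →
         F P? + F Q? + F R? ≡ length a + length b + length c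
    by e₁ e₂ e₃ = cong₂ _+_ (cong₂ _+_ (cong length e₁) (cong length e₂)) (cong length e₃)
    by-cases : Tri (P x) (Q x) (R x) → F P? + F Q? + F R? ≡ suc (length xs)
    by-cases (tri< p ¬q ¬r) = trans (by (filter-accept P? p) (filter-reject Q? ¬q) (filter-reject R? ¬r)) (cong suc ih)
    by-cases (tri≈ ¬p q ¬r) = trans (by (filter-reject P? ¬p) (filter-accept Q? q) (filter-reject R? ¬r))
                                (trans (cong (_+ length (List.filter R? xs)) (+-suc (length (List.filter P? xs)) _)) (cong suc ih))
    by-cases (tri> ¬p ¬q r) = trans (by (filter-reject P? ¬p) (filter-reject Q? ¬q) (filter-accept R? r))
                                (trans (+-suc _ _) (cong suc ih))

module _ {q : ℕ} where

  private
    prepend-all : ∀ k → Fin q → List (Vec (Fin q) (suc k))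
    prepend-all k u = List.map (u ∷_) (allTuples q k)

    head-of-prepend : ∀ {k u} {v : Vec (Fin q) (suc k)} → v ∈ prepend-all k u → Vec.head v ≡ u
    head-of-prepend v∈ with ∈-map⁻ _ v∈
    ... | _ , _ , refl = refl

  ∈-allTuples : ∀ k (v : Vec (Fin q) k) → v ∈ allTuples q k
  ∈-allTuples zero [] = here refl
  ∈-allTuples (suc k) (u ∷ v) = ∈-concatMap⁺ (prepend-all k)
    (Any.map (λ { refl → ∈-map⁺ (u ∷_) (∈-allTuples k v) }) (∈-allFin u))

  allTuples-unique : ∀ k → Unique (allTuples q k)
  allTuples-unique zero = All.[] AllPairs.∷ AllPairs.[]
  allTuples-unique (suc k) = concat-unique (List.allFin q) (allFin⁺ q)
    where
      concat-unique : ∀ us → Unique us → Unique (List.concatMap (prepend-all k) us)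
      concat-unique [] _ = AllPairs.[]
      concat-unique (u ∷ₗ us) (u∉us AllPairs.∷ us!) =
        ++⁺ (map⁺ ∷-injectiveʳ (allTuples-unique k)) (concat-unique us us!) λ (v∈u , v∈us) →
          All.lookup u∉us (subst (_∈ us) (head-of-prepend v∈u) (Any.map head-of-prepend (∈-concatMap⁻ (prepend-all k) v∈us))) refl

  length-allTuples : ∀ k → length (allTuples q k) ≡ q ^ k
  length-allTuples zero = refl
  length-allTuples (suc k) = trans (length-concat (List.allFin q)) (cong₂ _*_ (length-tabulate {n = q} (λ i → i)) (length-allTuples k))
    where
      length-concat : ∀ us → length (List.concatMap (prepend-all k) us) ≡ length us * length (allTuples q k)
      length-concat [] = refl
      length-concat (u ∷ₗ us) = trans (length-++ (prepend-all k u)) (cong₂ _+_ (length-map (u ∷_) (allTuples q k)) (length-concat us))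

-- Absorbing the light tuples

below⇒above : ∀ {a b N} → a + b ≡ N + N → b < N → N < a
below⇒above {a} {b} {N} e b<N = +-cancelʳ-< b N a (subst (N + b <_) (sym e) (+-monoʳ-< N b<N))

above⇒below : ∀ {a b N} → a + b ≡ N + N → N < b → a < N
above⇒below {a} {b} {N} e N<b = +-cancelʳ-< N a N (subst (a + N <_) e (+-monoʳ-< a N<b))

module Construction (q' n' : ℕ) where

  q : ℕ
  q = suc (suc (suc q'))

  open Rotation {q} n'

  Light : Tuple → Set
  Light v = weight doubled v < n * q

  open Cycles n' Light public

  private
    n*2q : n * (2 * q) ≡ n * q + n * q
    n*2q = solve 2 (λ n q → n :* (con 2 :* q) := n :* q :+ n :* q) refl n q
      where open +-*-Solver

  heavy-negRev : ∀ (v : Tuple) → Light v → n * q < weight doubled (negRev v)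
  heavy-negRev v = below⇒above (trans (doubled-negRev v) n*2q)

  light-negRev : ∀ (v : Tuple) → n * q < weight doubled v → Light (negRev v)
  light-negRev v = above⇒below (trans (doubled-negRev v) n*2q)

  light-rotate : ∀ v a → Light v → Light (rotate v a)
  light-rotate v a = subst (_< n * q) (sym (weight-rotate doubled v a))

  one : Fin q
  one = fsuc fzero

  ones : Tuple
  ones = Vec.replicate n one

  private
    doubled-≢one : ∀ {u} → u ≢ one → 2 < doubled u
    doubled-≢one {fzero} _ = s≤s (s≤s (s≤s z≤n))
    doubled-≢one {fsuc fzero} u≢one = ⊥-elim (u≢one refl)
    doubled-≢one {fsuc (fsuc u)} _ = *-monoʳ-< 2 (s≤s (s≤s z≤n))

    head-one-lighter : ∀ (v : Tuple) → Vec.head v ≢ one → weight doubled (one ∷ Vec.tail v) < weight doubled v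
    head-one-lighter (u ∷ v) u≢one = +-monoˡ-< (weight doubled v) (doubled-≢one u≢one)

    weight-replicate-one : ∀ k → weight doubled (Vec.replicate k one) ≡ k * 2
    weight-replicate-one zero = refl
    weight-replicate-one (suc k) = cong (λ x → 2 + x) (weight-replicate-one k)

    ≡ones : ∀ {v} → (∀ j → lookup v j ≡ one) → v ≡ ones
    ≡ones {v} all-one = trans (sym (tabulate∘lookup v))
      (trans (tabulate-cong (λ j → trans (all-one j) (sym (lookup-replicate j one)))) (tabulate∘lookup ones))

    rotate-ones : ∀ a → rotate ones a ≡ ones
    rotate-ones a = ≡ones (λ j → trans (lookup-window (cyclic ones) n a j) (lookup-replicate ((a + toℕ j) mod n) one))

    light-ones : Light ones
    light-ones = subst (_< n * q) (sym (weight-replicate-one n)) (*-monoʳ-< n (s≤s (s≤s (s≤s z≤n))))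

  Covers : Cycle → ℕ → Set
  Covers C k = ∀ v → weight doubled v < k → v ∈ᶜ C

  onesCycle : Cycle
  onesCycle = rotationCycle ones (λ a → light-rotate ones a light-ones)

  ones∈onesCycle : ones ∈ᶜ onesCycle
  ones∈onesCycle = 0 , rotate-0 ones

  -- x′ is lighter than v, hence on C, and has the same tail as x, which lies on the cycle of rotations of v.
  module Absorb (C : Cycle) (v : Tuple) (v∉C : ¬ v ∈ᶜ C) (light-v : Light v)
                (covers-lighter : Covers C (weight doubled v)) (j : Fin n) (vⱼ≢one : lookup v j ≢ one) where

    private
      x : Tuple
      x = rotate v (toℕ j)

      x′ : Tuple
      x′ = one ∷ Vec.tail x

      head-x : Vec.head x ≡ lookup v j
      head-x = trans (cong (cyclic v) (+-identityʳ (toℕ j))) (cyclic-toℕ v j)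

      x′∈C : x′ ∈ᶜ C
      x′∈C = covers-lighter x′ (subst (weight doubled x′ <_) (weight-rotate doubled v (toℕ j))
               (head-one-lighter x (vⱼ≢one ∘ trans (sym head-x))))

      D : Cycle
      D = rotationCycle x (λ a → light-rotate x a (light-rotate v (toℕ j) light-v))

      disjoint : ∀ s t → state C s ≢ state D t
      disjoint s t e with rotation-closed C s ((toℕ j + t) * n')
      ... | s′ , e′ = v∉C (s′ , (begin
          state C s′                                            ≡⟨ e′ ⟩
          rotate (state C s) ((toℕ j + t) * n')                 ≡⟨ cong (λ y → rotate y ((toℕ j + t) * n'))
                                                                       (trans e (rotate-rotate v (toℕ j) t)) ⟩
          rotate (rotate v (toℕ j + t)) ((toℕ j + t) * n')      ≡⟨ rotate-inverse v (toℕ j + t) ⟩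
          v                                                     ∎))
        where open ≡-Reasoning

      same-tail : Vec.tail (state C (proj₁ x′∈C)) ≡ Vec.tail (state D 0)
      same-tail = trans (cong Vec.tail (proj₂ x′∈C)) (cong Vec.tail (sym (rotate-0 x)))

      open Join C D (proj₁ x′∈C) 0 disjoint same-tail

    absorbed : Cycle
    absorbed = joined

    C⊆absorbed : C ⊆ᶜ absorbed
    C⊆absorbed = C⊆joined

    v∈absorbed : v ∈ᶜ absorbed
    v∈absorbed = D⊆joined (toℕ j * n' , rotate-inverse v (toℕ j))

  absorb : ∀ (C : Cycle) {v} → Light v → Covers C (weight doubled v) → ones ∈ᶜ C → ∃ λ D → C ⊆ᶜ D × v ∈ᶜ D
  absorb C {v} light-v covers ones∈C with v ∈ᶜ? C
  ... | yes v∈C = C , id , v∈C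
  ... | no v∉C with all? (λ j → lookup v j Fin.≟ one)
  ...   | yes all-one = ⊥-elim (v∉C (subst (_∈ᶜ C) (sym (≡ones all-one)) ones∈C))
  ...   | no ¬all-one with ¬∀⟶∃¬ n _ (λ j → lookup v j Fin.≟ one) ¬all-one
  ...     | j , vⱼ≢one = absorbed , C⊆absorbed , v∈absorbed
    where open Absorb C v v∉C light-v covers j vⱼ≢one

  absorb-all : ∀ {k} → k < n * q → (C : Cycle) → Covers C k → ones ∈ᶜ C → (vs : List Tuple) →
               ∃ λ D → C ⊆ᶜ D × (∀ {v} → v ∈ vs → weight doubled v ≡ k → v ∈ᶜ D)
  absorb-all k< C covers ones∈C [] = C , id , λ ()
  absorb-all {k} k< C covers ones∈C (v ∷ₗ vs) with weight doubled v ℕ.≟ k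
  ... | no w≢k =
    let (D , C⊆D , vs⊆D) = absorb-all k< C covers ones∈C vs
    in D , C⊆D , λ { (here refl) w≡k → ⊥-elim (w≢k w≡k) ; (there v∈vs) → vs⊆D v∈vs }
  ... | yes refl =
    let (D₁ , C⊆D₁ , v∈D₁) = absorb C k< covers ones∈C
        (D₂ , D₁⊆D₂ , vs⊆D₂) = absorb-all k< D₁ (λ u w<k → C⊆D₁ (covers u w<k)) (C⊆D₁ ones∈C) vs
    in D₂ , D₁⊆D₂ ∘ C⊆D₁ , λ { (here refl) _ → D₁⊆D₂ v∈D₁ ; (there v∈vs) → vs⊆D₂ v∈vs }

  covering-cycle : ∀ k → k ≤ n * q → ∃ λ C → Covers C k × ones ∈ᶜ C
  covering-cycle zero _ = onesCycle , (λ _ ()) , ones∈onesCycle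
  covering-cycle (suc k) k<nq =
    let (C , covers , ones∈C) = covering-cycle k (≤-trans (n≤1+n k) k<nq)
        (D , C⊆D , level⊆D) = absorb-all k<nq C covers ones∈C (allTuples q n)
        covers′ : Covers D (suc k)
        covers′ u w<k+1 = [ (λ w<k → C⊆D (covers u w<k)) , level⊆D (∈-allTuples n u) ]′ (m≤n⇒m<n∨m≡n (ℕ.s≤s⁻¹ w<k+1))
    in D , covers′ , C⊆D ones∈C

  select : ∀ {P : Tuple → Set} → Decidable P → List Tuple
  select P? = List.filter P? (allTuples q n)

  ∈-select⁺ : ∀ {P : Tuple → Set} (P? : Decidable P) {v} → P v → v ∈ select P?
  ∈-select⁺ P? {v} = ∈-filter⁺ P? (∈-allTuples n v)

  ∈-select⁻ : ∀ {P : Tuple → Set} (P? : Decidable P) {v} → v ∈ select P? → P v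
  ∈-select⁻ P? = proj₂ ∘ ∈-filter⁻ P? {xs = allTuples q n}

  light? : Decidable Light
  light? v = weight doubled v <? n * q

  balanced? : Decidable (λ (v : Tuple) → weight doubled v ≡ n * q)
  balanced? v = weight doubled v ℕ.≟ n * q

  heavy? : Decidable (λ (v : Tuple) → n * q < weight doubled v)
  heavy? v = n * q <? weight doubled v

  length-select-heavy : length (select heavy?) ≡ length (select light?)
  length-select-heavy = begin
      length (select heavy?)               ≡⟨ length-unique-≡ (filter⁺ heavy? (allTuples-unique n)) negRev-lights!
                                                    heavy⊆negRev-light negRev-light⊆heavy ⟩
      length (List.map ν (select light?))  ≡⟨ length-map ν (select light?) ⟩
      length (select light?)               ∎
    where
      open ≡-Reasoning
      ν : Tuple → Tuple
      ν = negRev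
      negRev-lights! : Unique (List.map ν (select light?))
      negRev-lights! = map⁺ (λ {u} {v} e → trans (sym (negRev-involutive u)) (trans (cong negRev e) (negRev-involutive v)))
                            (filter⁺ light? (allTuples-unique n))
      heavy⊆negRev-light : ∀ {v} → v ∈ select heavy? → v ∈ List.map ν (select light?)
      heavy⊆negRev-light {v} v∈ = subst (_∈ List.map ν (select light?)) (negRev-involutive v)
                        (∈-map⁺ ν (∈-select⁺ light? {negRev v} (light-negRev v (∈-select⁻ heavy? v∈))))
      negRev-light⊆heavy : ∀ {v} → v ∈ List.map ν (select light?) → v ∈ select heavy?
      negRev-light⊆heavy v∈ = let (u , u∈ , v≡νu) = ∈-map⁻ ν v∈ in
        subst (_∈ select heavy?) (sym v≡νu) (∈-select⁺ heavy? (heavy-negRev u (∈-select⁻ light? u∈)))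

  r≡length-select-balanced : r q n (+ (n * q) / 2) ≡ length (select balanced?)
  r≡length-select-balanced = cong length (filter-≐ (λ v → pseudoweight v ≟ℚ + (n * q) / 2) balanced?
    ((λ {v} → Equivalence.to (pseudoweight≡half⇔ v (n * q))) , (λ {v} → Equivalence.from (pseudoweight≡half⇔ v (n * q))))
    (allTuples q n))

  module _ (C : Cycle) where

    sequence : Seq q
    sequence = heads (state C) (state-↝ C)

    window-sequence : ∀ t → window sequence n t ≡ state C t
    window-sequence = window-heads (state C) (state-↝ C)

    sequence-negOrientable : IsNegOrientable n (period C) sequence
    sequence-negOrientable = ((s≤s z≤n , λ t → cong (λ v → lookup v fzero) (state-periodic C t)) , distinct) , no-negRev
      where
        distinct : ∀ i j → window sequence n i ≡ window sequence n j → i ≡ j [mod period C ]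
        distinct i j e = state-injective C i j (trans (sym (window-sequence i)) (trans e (window-sequence j)))
        no-negRev : ∀ i j → window sequence n i ≢ negRev (window sequence n j)
        no-negRev i j e = <-asym (heavy-negRev (state C j) (state-allowed C j))
          (subst Light (trans (sym (window-sequence i)) (trans e (cong negRev (window-sequence j)))) (state-allowed C i))

  module _ (C : Cycle) (covers : Covers C (n * q)) where

    period≡length-select-light : period C ≡ length (select light?)
    period≡length-select-light = begin
        period C                                      ≡⟨ sym (length-applyUpTo (state C) (period C)) ⟩
        length (List.applyUpTo (state C) (period C))  ≡⟨ length-unique-≡ states! (filter⁺ light? (allTuples-unique n))
                                                             states⊆ lights⊆ ⟩
        length (select light?)                        ∎
      where
        open ≡-Reasoning
        states! : Unique (List.applyUpTo (state C) (period C))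
        states! = applyUpTo⁺₁ (state C) (period C)
          (λ i<j j<p e → <⇒≢ i<j (≡[mod]⇒≡ (<-trans i<j j<p) j<p (state-injective C _ _ e)))
        states⊆ : ∀ {v} → v ∈ List.applyUpTo (state C) (period C) → v ∈ select light?
        states⊆ v∈ with ∈-applyUpTo⁻ (state C) v∈
        ... | t , _ , refl = ∈-select⁺ light? (state-allowed C t)
        lights⊆ : ∀ {v} → v ∈ select light? → v ∈ List.applyUpTo (state C) (period C)
        lights⊆ {v} v∈ = let (t , state≡v) = covers v (∈-select⁻ light? v∈) in
          subst (_∈ List.applyUpTo (state C) (period C)) (trans (sym (periodic-% (state-periodic C) t)) state≡v)
            (∈-applyUpTo⁺ (state C) (m%n<n t (period C)))

    count : 2 * period C + r q n (+ (n * q) / 2) ≡ q ^ n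
    count = begin
        2 * period C + r q n (+ (n * q) / 2)        ≡⟨ cong₂ (λ a b → 2 * a + b) period≡length-select-light r≡length-select-balanced ⟩
        2 * L + B                                   ≡⟨ solve 2 (λ L B → con 2 :* L :+ B := L :+ B :+ L) refl L B ⟩
        L + B + L                                   ≡⟨ cong (λ H → L + B + H) (sym length-select-heavy) ⟩
        L + B + length (select heavy?)              ≡⟨ length-filter-Tri light? balanced? heavy? (λ v → <-cmp _ _) (allTuples q n) ⟩
        length (allTuples q n)                      ≡⟨ length-allTuples n ⟩
        q ^ n                                       ∎
      where
        open ≡-Reasoning
        open +-*-Solver
        L = length (select light?)
        B = length (select balanced?)

lemma6 : ∀ (q n : ℕ) .{{_ : NonZero q}} → 2 < q → n ≥ 2 →
    ∃ λ (m : ℕ) → (2 * m + r q n (+ (n * q) / 2) ≡ q ^ n)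
    × ∃ λ (s : Seq q) → IsNegOrientable n m s
lemma6 (suc (suc (suc q'))) (suc n') _ _ =
  let (C , covers , _) = covering-cycle _ ≤-refl
  in period C , count C covers , sequence C , sequence-negOrientable C
  where open Construction q' n'
lemma6 (suc zero) _ (s≤s ()) _
lemma6 (suc (suc zero)) _ (s≤s (s≤s ())) _
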